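{- Fix a positive integer $n$ and consider the Zeckendorf Game started from the multiset $\{F_1^n\}$ ($n$ copies of $F_1=1$). Every play of the game (every sequence of legal moves, chosen in any way) terminates after a finite number of moves, and when no legal move remains the multiset is the Zeckendorf decomposition of $n$.
   Context: Fibonacci numbers are indexed as $F_1=1$, $F_2=2$, $F_{i+1}=F_i+F_{i-1}$ (so $1,2,3,5,8,\dots$). Zeckendorf's theorem: every positive integer $n$ is uniquely a sum of distinct, pairwise non-adjacent Fibonacci numbers (in this indexing); this is the Zeckendorf decomposition of $n$. The Zeckendorf Game on $n$: the state is an unordered multiset of Fibonacci numbers summing to $n$, initially $\{F_1^n\}$. Two players alternate turns; on a turn a player performs one of the following moves: (1) if the multiset contains $F_{i-1}$ and $F_i$ (consecutive Fibonacci numbers), replace them by $F_{i+1}$; (2a) replace two copies of $F_1$ by $F_2$; (2b) replace two copies of $F_2$ by $F_1$ and $F_3$; (2c) for $i\ge 3$, replace two copies of $F_i$ by $F_{i-2}$ and $F_{i+1}$. The player who makes the last move wins. -}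

module Defs where

open import Data.Nat using (ℕ; zero; suc; _+_; _≤_; _<_)
open import Data.List using (List; []; _∷_; _++_; replicate; map)
open import Data.Nat.ListAction using (sum)
open import Relation.Binary.PropositionalEquality using (_≡_)
open import Data.List.Relation.Binary.Permutation.Propositional using (_↭_)
open import Data.List.Relation.Unary.All using (All)
open import Data.List.Relation.Unary.AllPairs using (AllPairs)
open import Data.Product using (Σ; ∃; _×_)
open import Data.Sum using (_⊎_)
open import Relation.Binary.Construct.Closure.ReflexiveTransitive using (Star)
open import Relation.Nullary using (¬_)

-- Fibonacci numbers in the paper's indexing: F 1 = 1, F 2 = 2, F (i+2) = F (i+1) + F i.
-- (F 0 = 1 is only there to make the recurrence total; index 0 never occurs.)
F : ℕ → ℕ
F zero = 1
F (suc zero) = 1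
F (suc (suc i)) = F (suc i) + F i

-- A game state: a finite multiset of Fibonacci numbers, represented as a list of
-- their indices i (standing for F i); lists are considered up to permutation (_↭_).
State : Set
State = List ℕ

value : State → ℕ
value s = sum (map F s)

data Move : List ℕ → List ℕ → Set where
  -- (1)  F_{i-1}, F_i  ↦  F_{i+1}   (i ≥ 2, written i = j+1 with j ≥ 1)
  combine : ∀ j → 1 ≤ j → Move (j ∷ suc j ∷ []) (suc (suc j) ∷ [])
  split1  : Move (1 ∷ 1 ∷ []) (2 ∷ [])
  split2  : Move (2 ∷ 2 ∷ []) (1 ∷ 3 ∷ [])
  -- (2c) F_i, F_i  ↦  F_{i-2}, F_{i+1}   (i ≥ 3, written i = j+2 with j ≥ 1)
  splitk  : ∀ j → 1 ≤ j → Move (suc (suc j) ∷ suc (suc j) ∷ []) (j ∷ suc (suc (suc j)) ∷ [])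

Step : State → State → Set
Step s t = Σ (List ℕ) λ a → Σ (List ℕ) λ b → Σ (List ℕ) λ r →
  Move a b × (s ↭ a ++ r) × (t ↭ b ++ r)

start : ℕ → State
start n = replicate n 1

Reachable : State → State → Set
Reachable = Star Step

Terminal : State → Set
Terminal s = ∀ t → ¬ Step s t

FarApart : ℕ → ℕ → Set
FarApart i j = suc i < j ⊎ suc j < i

IsZeckendorfOf : ℕ → State → Set
IsZeckendorfOf n s = All (1 ≤_) s × AllPairs FarApart s × value s ≡ n

module Submission where

open import Defs
open import Data.Nat using (ℕ; _≤_)
open import Data.Product using (_×_)
open import Induction.WellFounded using (Acc)
open import Function using (flip)

open import Data.Nat using (zero; suc; _+_; _<_; _<?_; z≤n; s≤s)
open import Data.Nat.Properties using (<-cmp; m≤n+m; +-monoˡ-<; m≤n⇒m<n∨m≡n)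
open import Data.Nat.Induction using (<-wellFounded)
open import Data.List using (List; []; _∷_; _++_; map)
open import Data.Nat.ListAction using (sum)
open import Data.Nat.ListAction.Properties using (sum-↭; sum-++)
open import Data.List.Properties using (map-++)
open import Data.List.Relation.Binary.Permutation.Propositional using (_↭_; ↭-refl; ↭-sym; ↭-trans; ↭-swap; ↭-prep)
open import Data.List.Relation.Binary.Permutation.Propositional.Properties using (map⁺; All-resp-↭; shift)
open import Data.List.Relation.Unary.All as All using (All; []; _∷_)
open import Data.List.Relation.Unary.All.Properties using (++⁺; ++⁻ʳ)
open import Data.List.Relation.Unary.AllPairs using (AllPairs; []; _∷_)
open import Data.List.Membership.Propositional using (_∈_)
open import Data.List.Membership.Propositional.Properties using (∈-∃++)
open import Data.Product using (_,_)
open import Data.Sum using (inj₁; inj₂)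
open import Relation.Binary.PropositionalEquality using (_≡_; refl; trans; cong)
open import Relation.Binary.Construct.Closure.ReflexiveTransitive using (Star; ε; _◅_)
open import Relation.Binary using (tri<; tri≈; tri>)
open import Relation.Binary.Construct.On as On using ()
open import Induction.WellFounded using (WellFounded; module Subrelation)
open import Data.Empty using (⊥-elim)
open import Data.Nat.Tactic.RingSolver using (solve-∀)
open import Relation.Nullary.Decidable using (True; toWitness)

-- A state is a list of Fibonacci indices up to permutation, and every move
-- rewrites a two-element sub-multiset while leaving the rest (the frame)
-- untouched.  So any additive quantity  weight g s = Σ g(i)  changes by the
-- same amount as on the rewritten part alone.
--
-- Termination: with the potential w(1) = 3, w(i) = i + 3 for i ≥ 2, every
-- local move strictly decreases Σ w; hence the move relation embeds into
-- _<_ on ℕ and is well-founded.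
--
-- Correctness: the local moves preserve the value Σ F(i) and positivity of
-- the indices, hence so does every play from {F_1^n}.  A state with no legal
-- move cannot contain two equal or two adjacent indices (some move would
-- apply), so a terminal state is a set of pairwise far-apart Fibonacci
-- numbers summing to n: its Zeckendorf decomposition.

weight : (ℕ → ℕ) → State → ℕ
weight g s = sum (map g s)

weight-↭ : ∀ g {s t} → s ↭ t → weight g s ≡ weight g t
weight-↭ g p = sum-↭ (map⁺ g p)

weight-++ : ∀ g s r → weight g (s ++ r) ≡ weight g s + weight g r
weight-++ g s r = trans (cong sum (map-++ g s r)) (sum-++ (map g s) (map g r))

weight-frame : ∀ g {s a r} → s ↭ a ++ r → weight g s ≡ weight g a + weight g r
weight-frame g {a = a} {r} p = trans (weight-↭ g p) (weight-++ g a r)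

step-weight : ∀ g (_R_ : ℕ → ℕ → Set) → (∀ {x y} z → x R y → (x + z) R (y + z)) →
  (∀ {a b} → Move a b → weight g b R weight g a) →
  ∀ {s t} → Step s t → weight g t R weight g s
step-weight g _R_ frame local {s} {t} (a , b , r , m , p , q)
  rewrite weight-frame g {t} {b} {r} q | weight-frame g {s} {a} {r} p = frame (weight g r) (local m)

-- The potential; only indices ≥ 1 occur, index 0 is given weight 0.
potential : ℕ → ℕ
potential zero = 0
potential (suc zero) = 3
potential (suc (suc k)) = k + 5

by-computation : ∀ {m n} {_ : True (m <? n)} → m < n
by-computation {_} {_} {t} = toWitness t

-- a < c + suc a, in the form needed after normalising both sides.
<-of-≡ : ∀ {a b} c → b ≡ c + suc a → a < b
<-of-≡ {a} c refl = m≤n+m (suc a) c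

move-potential : ∀ {a b} → Move a b → weight potential b < weight potential a
move-potential (combine (suc zero) _) = by-computation
move-potential (combine (suc (suc k)) _) = <-of-≡ (k + 3) (combine-gap k)
  where
  -- w(k+2) + w(k+3) = (k+3) + (1 + w(k+4))
  combine-gap : ∀ k → k + 5 + (suc k + 5 + 0) ≡ (k + 3) + suc (suc (suc k) + 5 + 0)
  combine-gap = solve-∀
move-potential split1 = by-computation
move-potential split2 = by-computation
move-potential (splitk (suc zero) _) = by-computation
move-potential (splitk (suc (suc k)) _) = <-of-≡ 0 (split-gap k)
  where
  -- 2 w(k+4) = 1 + w(k+2) + w(k+5)
  split-gap : ∀ k → suc (suc k) + 5 + (suc (suc k) + 5 + 0) ≡ 0 + suc (k + 5 + (suc (suc (suc k)) + 5 + 0))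
  split-gap = solve-∀

step-wellFounded : WellFounded (flip Step)
step-wellFounded =
  Subrelation.wellFounded
    (step-weight potential _<_ (λ z → +-monoˡ-< z) move-potential)
    (On.wellFounded (weight potential) <-wellFounded)

Positive : State → Set
Positive = All (1 ≤_)

-- Every move produces indices ≥ 1 (for 2c this uses the side condition j ≥ 1).
move-positive : ∀ {a b} → Move a b → Positive b
move-positive (combine j _) = s≤s z≤n ∷ []
move-positive split1 = s≤s z≤n ∷ []
move-positive split2 = s≤s z≤n ∷ s≤s z≤n ∷ []
move-positive (splitk j 1≤j) = 1≤j ∷ s≤s z≤n ∷ []

step-positive : ∀ {s t} → Step s t → Positive s → Positive t
step-positive (a , b , r , m , p , q) pos =
  let pos-ar = All-resp-↭ p pos in
  All-resp-↭ (↭-sym q) (++⁺ (move-positive m) (++⁻ʳ a pos-ar))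

move-value : ∀ {a b} → Move a b → value b ≡ value a
move-value (combine j _) = F-recurrence (F j) (F (suc j))
  where
  -- F(j+2) = F(j+1) + F(j)
  F-recurrence : ∀ u v → (v + u) + 0 ≡ u + (v + 0)
  F-recurrence = solve-∀
move-value split1 = refl
move-value split2 = refl
move-value (splitk j _) = double-identity (F j) (F (suc j))
  where
  -- F(j) + F(j+3) = 2 F(j+2), written in F(j) and F(j+1)
  double-identity : ∀ u v → u + ((v + u + v) + 0) ≡ (v + u) + ((v + u) + 0)
  double-identity = solve-∀

step-value : ∀ {s t} → Step s t → value t ≡ value s
step-value = step-weight F _≡_ (λ z → cong (_+ z)) move-value

star-invariant : ∀ {P : State → Set} → (∀ {s t} → Step s t → P s → P t) →
  ∀ {s t} → Star Step s t → P s → P t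
star-invariant step ε ps = ps
star-invariant step (st ◅ sts) ps = star-invariant step sts (step st ps)

Invariant : ℕ → State → Set
Invariant n s = Positive s × value s ≡ n

step-invariant : ∀ {n s t} → Step s t → Invariant n s → Invariant n t
step-invariant st (pos , val) = step-positive st pos , trans (step-value st) val

start-invariant : ∀ n → Invariant n (start n)
start-invariant zero = [] , refl
start-invariant (suc n) with start-invariant n
... | pos , val = s≤s z≤n ∷ pos , cong suc val

terminal-↭ : ∀ {s s'} → s ↭ s' → Terminal s → Terminal s'
terminal-↭ s↭s' T t (a , b , r , m , p , q) = T t (a , b , r , m , ↭-trans s↭s' p , q)

-- Removing an element keeps a state terminal: a move in the rest would
-- also be a move in the whole, with the removed element added to the frame.
terminal-tail : ∀ {x xs} → Terminal (x ∷ xs) → Terminal xs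
terminal-tail {x} T t (a , b , r , m , p , q) =
  T (x ∷ t) (a , b , x ∷ r , m ,
             ↭-trans (↭-prep x p) (↭-sym (shift x a r)) ,
             ↭-trans (↭-prep x q) (↭-sym (shift x b r)))

-- In a terminal state the first two indices are far apart: equal indices
-- admit a split move (2a/2b/2c), adjacent ones the combine move (1).
terminal-head-far : ∀ x y r → Terminal (x ∷ y ∷ r) → 1 ≤ x → 1 ≤ y → FarApart x y
terminal-head-far x y r T 1≤x 1≤y with <-cmp x y
... | tri< x<y _ _ with m≤n⇒m<n∨m≡n x<y
...   | inj₁ far = inj₁ far
...   | inj₂ refl = ⊥-elim (T _ (_ , _ , r , combine x 1≤x , ↭-refl , ↭-refl))
terminal-head-far x y r T 1≤x 1≤y | tri> _ _ y<x with m≤n⇒m<n∨m≡n y<x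
...   | inj₁ far = inj₂ far
...   | inj₂ refl = ⊥-elim (T _ (_ , _ , r , combine y 1≤y , ↭-swap x y ↭-refl , ↭-refl))
terminal-head-far (suc zero) _ r T _ _ | tri≈ _ refl _ =
  ⊥-elim (T _ (_ , _ , r , split1 , ↭-refl , ↭-refl))
terminal-head-far (suc (suc zero)) _ r T _ _ | tri≈ _ refl _ =
  ⊥-elim (T _ (_ , _ , r , split2 , ↭-refl , ↭-refl))
terminal-head-far (suc (suc (suc k))) _ r T _ _ | tri≈ _ refl _ =
  ⊥-elim (T _ (_ , _ , r , splitk (suc k) (s≤s z≤n) , ↭-refl , ↭-refl))

-- The head of a positive terminal state is far from every other element:
-- bring that element next to the head by a permutation.
terminal-head-far-all : ∀ x xs → Terminal (x ∷ xs) → 1 ≤ x → Positive xs → All (FarApart x) xs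
terminal-head-far-all x xs T 1≤x pos = All.tabulate far
  where
  far : ∀ {y} → y ∈ xs → FarApart x y
  far {y} y∈xs with ∈-∃++ y∈xs
  ... | p , q , refl =
    terminal-head-far x y (p ++ q) (terminal-↭ (↭-prep x (shift y p q)) T) 1≤x (All.lookup pos y∈xs)

terminal-far-apart : ∀ s → Positive s → Terminal s → AllPairs FarApart s
terminal-far-apart [] _ _ = []
terminal-far-apart (x ∷ xs) (1≤x ∷ pos) T =
  terminal-head-far-all x xs T 1≤x pos ∷ terminal-far-apart xs pos (terminal-tail T)

theorem1p2 : (n : ℕ) → 1 ≤ n →
    Acc (flip Step) (start n) ×
    (∀ s → Reachable (start n) s → Terminal s → IsZeckendorfOf n s)
theorem1p2 n _ = step-wellFounded (start n) , zeckendorf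
  where
  zeckendorf : ∀ s → Reachable (start n) s → Terminal s → IsZeckendorfOf n s
  zeckendorf s play T with star-invariant step-invariant play (start-invariant n)
  ... | pos , val = pos , terminal-far-apart s pos T , val
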